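{- For every integer $N\ge 0$, \[ F_{N}-1=\frac{1}{N!}\left(\sum_{i=1}^{\left[\frac{N+1}{2}\right]}\sum_{k_{i}=1}^{N+1-2i}\sum_{k_{i-1}=1}^{k_{i}+1}\cdots\sum_{k_{1}=1}^{k_{2}+1}2^{i}\left(\prod_{l=1}^{i}k_{l}\right)(N-i)!\right). \]
   Context: The Fibonacci numbers here are indexed so that $F_0=1$, $F_1=1$, $F_n=F_{n-1}+F_{n-2}$ for $n\ge 2$. $[y]$ denotes the greatest integer not exceeding $y$. For each $i$, the inner nested sum has the outermost index $k_i$ running from $1$ to $N+1-2i$ and each inner index $k_{j-1}$ running from $1$ to $k_j+1$ (for $i=1$ it is the single sum over $k_1$ from $1$ to $N-1$); empty sums are $0$. -}

module Defs where

open import Data.Nat using (ℕ; zero; suc; _+_; _*_; _∸_; _^_; _/_; _!)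

F : ℕ → ℕ
F zero = 1
F (suc zero) = 1
F (suc (suc n)) = F (suc n) + F n

Σ1 : ℕ → (ℕ → ℕ) → ℕ
Σ1 zero f = 0
Σ1 (suc m) f = Σ1 m f + f (suc m)

-- nested j b = Σ_{k_j=1}^{b} Σ_{k_{j-1}=1}^{k_j+1} ⋯ Σ_{k_1=1}^{k_2+1} k_1 k_2 ⋯ k_j
nested : ℕ → ℕ → ℕ
nested zero b = 1
nested (suc j) b = Σ1 b (λ k → k * nested j (suc k))

-- the big sum in the corollary (numerator, before dividing by N!)
bigSum : ℕ → ℕ
bigSum N = Σ1 ((N + 1) / 2) (λ i → nested i (N + 1 ∸ 2 * i) * 2 ^ i * (N ∸ i) !)

-- Induction on j and c shows 2^j j! c! · nested j (c+1) = (c+2j)!, so the i-th summand of bigSum N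
-- is N! · C(N-i, i) (and vanishes once 2i > N). Dividing by N! leaves the shallow-diagonal
-- identity F N = Σ_{i≥0} C(N-i, i), which follows from Pascal's rule by induction on N.
module Submission where

open import Defs
open import Data.Nat using (ℕ; zero; suc; pred; _+_; _*_; _∸_; _^_; _/_; _%_; _!; _≤_; _<_; z≤n; _≤?_; s≤s; s≤s⁻¹)
open import Data.Nat.Properties
open import Data.Nat.DivMod using (m≡m%n+[m/n]*n; m%n<n; m/n*n≡m)
open import Data.Nat.Combinatorics
  using (_C_; nCk≡n!/k![n-k]!; k>n⇒nCk≡0; k![n∸k]!∣n!; nCk+nC[k+1]≡[n+1]C[k+1])
open import Data.Nat.Tactic.RingSolver using (solve-∀)
open import Relation.Binary.PropositionalEquality
  using (_≡_; refl; sym; trans; cong; cong₂; subst; module ≡-Reasoning)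
open import Relation.Nullary using (yes; no; contradiction)

Σ1-cong : ∀ m {f g : ℕ → ℕ} → (∀ k → f (suc k) ≡ g (suc k)) → Σ1 m f ≡ Σ1 m g
Σ1-cong zero    f≗g = refl
Σ1-cong (suc m) f≗g = cong₂ _+_ (Σ1-cong m f≗g) (f≗g m)

Σ1-≡0 : ∀ m {f : ℕ → ℕ} → (∀ k → f (suc k) ≡ 0) → Σ1 m f ≡ 0
Σ1-≡0 zero    f≗0 = refl
Σ1-≡0 (suc m) f≗0 = cong₂ _+_ (Σ1-≡0 m f≗0) (f≗0 m)

Σ1-distrib-+ : ∀ m (f g : ℕ → ℕ) → Σ1 m (λ i → f i + g i) ≡ Σ1 m f + Σ1 m g
Σ1-distrib-+ zero    f g = refl
Σ1-distrib-+ (suc m) f g = trans (cong (_+ (f (suc m) + g (suc m))) (Σ1-distrib-+ m f g))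
                                 (+-interchange (Σ1 m f) (Σ1 m g) (f (suc m)) (g (suc m)))
  where
  +-interchange : ∀ a b c d → a + b + (c + d) ≡ a + c + (b + d)
  +-interchange = solve-∀

*-distribˡ-Σ1 : ∀ m a (f : ℕ → ℕ) → a * Σ1 m f ≡ Σ1 m (λ i → a * f i)
*-distribˡ-Σ1 zero    a f = *-zeroʳ a
*-distribˡ-Σ1 (suc m) a f = trans (*-distribˡ-+ a (Σ1 m f) (f (suc m)))
                                  (cong (_+ a * f (suc m)) (*-distribˡ-Σ1 m a f))

Σ1-pred : ∀ m (f : ℕ → ℕ) → Σ1 (suc m) (λ i → f (pred i)) ≡ f 0 + Σ1 m f
Σ1-pred zero    f = +-comm 0 (f 0)
Σ1-pred (suc m) f = trans (cong (_+ f (suc m)) (Σ1-pred m f)) (+-assoc (f 0) (Σ1 m f) (f (suc m)))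

diagonal : ℕ → ℕ → ℕ
diagonal n i = (n ∸ i) C i

diagonal-pascal : ∀ n k → diagonal (suc (suc n)) (suc k) ≡ diagonal (suc n) (suc k) + diagonal n k
diagonal-pascal n k with k ≤? n
... | yes k≤n rewrite +-∸-assoc 1 k≤n =
  sym (trans (+-comm ((n ∸ k) C suc k) ((n ∸ k) C k)) (nCk+nC[k+1]≡[n+1]C[k+1] (n ∸ k) k))
... | no k≰n rewrite m≤n⇒m∸n≡0 (≰⇒> k≰n) | m≤n⇒m∸n≡0 (<⇒≤ (≰⇒> k≰n))
                   | k>n⇒nCk≡0 {0} {k} (≤-trans (s≤s z≤n) (≰⇒> k≰n)) = refl

fib-diagonal : ∀ n m → n ≤ m + m → Σ1 m (diagonal n) + 1 ≡ F n
fib-diagonal zero          m _ = cong (_+ 1) (Σ1-≡0 m λ _ → refl)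
fib-diagonal (suc zero)    m _ = cong (_+ 1) (Σ1-≡0 m λ k → cong (_C suc k) (0∸n≡0 k))
fib-diagonal (suc (suc n)) zero    ()
fib-diagonal (suc (suc n)) (suc m) n+2≤2m+2 = begin
    Σ1 (suc m) (diagonal (2 + n)) + 1
  ≡⟨ cong (_+ 1) (Σ1-cong (suc m) (diagonal-pascal n)) ⟩
    Σ1 (suc m) (λ i → diagonal (1 + n) i + diagonal n (pred i)) + 1
  ≡⟨ cong (_+ 1) (Σ1-distrib-+ (suc m) (diagonal (1 + n)) (λ i → diagonal n (pred i))) ⟩
    Σ1 (suc m) (diagonal (1 + n)) + Σ1 (suc m) (λ i → diagonal n (pred i)) + 1
  ≡⟨ cong (λ s → Σ1 (suc m) (diagonal (1 + n)) + s + 1) (Σ1-pred m (diagonal n)) ⟩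
    Σ1 (suc m) (diagonal (1 + n)) + (1 + Σ1 m (diagonal n)) + 1
  ≡⟨ regroup (Σ1 (suc m) (diagonal (1 + n))) (Σ1 m (diagonal n)) ⟩
    (Σ1 (suc m) (diagonal (1 + n)) + 1) + (Σ1 m (diagonal n) + 1)
  ≡⟨ cong₂ _+_ (fib-diagonal (suc n) (suc m) (≤-trans (n≤1+n _) n+2≤2m+2)) (fib-diagonal n m n≤2m) ⟩
    F (suc (suc n)) ∎
  where
  open ≡-Reasoning
  regroup : ∀ a b → a + (1 + b) + 1 ≡ (a + 1) + (b + 1)
  regroup = solve-∀
  n≤2m : n ≤ m + m
  n≤2m = s≤s⁻¹ (subst (suc n ≤_) (+-suc m m) (s≤s⁻¹ n+2≤2m+2))

+-2*-suc : ∀ c j → c + 2 * suc j ≡ 2 + c + 2 * j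
+-2*-suc = solve-∀

nested-closed-form : ∀ j c → 2 ^ j * j ! * c ! * nested j (suc c) ≡ (c + 2 * j) !
nested-closed-form zero    c = trans (unit-factors (c !)) (cong _! (sym (+-identityʳ c)))
  where
  unit-factors : ∀ x → 1 * 1 * x * 1 ≡ x
  unit-factors = solve-∀
nested-closed-form (suc j) zero = begin
    2 * 2 ^ j * ((1 + j) * j !) * 1 * (0 + 1 * nested j 2)
  ≡⟨ pull-out (2 ^ j) (j !) (nested j 2) j ⟩
    (2 + 2 * j) * (2 ^ j * j ! * 1 ! * nested j 2)
  ≡⟨ cong ((2 + 2 * j) *_) (nested-closed-form j 1) ⟩
    (2 + 2 * j) * (1 + 2 * j) !
  ≡⟨ cong _! (sym (+-2*-suc 0 j)) ⟩
    (0 + 2 * suc j) ! ∎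
  where
  open ≡-Reasoning
  pull-out : ∀ p f x j → 2 * p * ((1 + j) * f) * 1 * (0 + 1 * x) ≡ (2 + 2 * j) * (p * f * 1 * x)
  pull-out = solve-∀
nested-closed-form (suc j) (suc c) = begin
    2 * 2 ^ j * ((1 + j) * j !) * ((1 + c) * c !) * (nested (suc j) (suc c) + (2 + c) * nested j (3 + c))
  ≡⟨ split (2 ^ j) (j !) (c !) (nested (suc j) (suc c)) (nested j (3 + c)) c j ⟩
    (1 + c) * (2 ^ suc j * suc j ! * c ! * nested (suc j) (suc c))
      + 2 * (1 + j) * (2 ^ j * j ! * (2 + c) ! * nested j (3 + c))
  ≡⟨ cong₂ (λ a b → (1 + c) * a + 2 * (1 + j) * b) (nested-closed-form (suc j) c) (nested-closed-form j (2 + c)) ⟩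
    (1 + c) * (c + 2 * suc j) ! + 2 * (1 + j) * (2 + c + 2 * j) !
  ≡⟨ cong (λ k → (1 + c) * k ! + 2 * (1 + j) * (2 + c + 2 * j) !) (+-2*-suc c j) ⟩
    (1 + c) * (2 + c + 2 * j) ! + 2 * (1 + j) * (2 + c + 2 * j) !
  ≡⟨ collect ((2 + c + 2 * j) !) c j ⟩
    (3 + c + 2 * j) !
  ≡⟨ cong _! (sym (+-2*-suc (suc c) j)) ⟩
    (suc c + 2 * suc j) ! ∎
  where
  open ≡-Reasoning
  split : ∀ p f g x y c j →
    2 * p * ((1 + j) * f) * ((1 + c) * g) * (x + (2 + c) * y)
      ≡ (1 + c) * (2 * p * ((1 + j) * f) * g * x) + 2 * (1 + j) * (p * f * ((2 + c) * ((1 + c) * g)) * y)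
  split = solve-∀
  collect : ∀ b c j → (1 + c) * b + 2 * (1 + j) * b ≡ (3 + c + 2 * j) * b
  collect = solve-∀

nCk*k!*[n∸k]!≡n! : ∀ {n k} → k ≤ n → (n C k) * (k ! * (n ∸ k) !) ≡ n !
nCk*k!*[n∸k]!≡n! {n} {k} k≤n =
  trans (cong (_* (k ! * (n ∸ k) !)) (nCk≡n!/k![n-k]! k≤n))
        (m/n*n≡m {{k !* (n ∸ k) !≢0}} (k![n∸k]!∣n! k≤n))

nested-binomial : ∀ i c → nested i (suc c) * 2 ^ i * (c + i) ! ≡ (c + 2 * i) ! * ((c + i) C i)
nested-binomial i c = *-cancelʳ-≡ _ _ (i ! * c !) {{i !* c !≢0}} (begin
    nested i (suc c) * 2 ^ i * (c + i) ! * (i ! * c !)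
  ≡⟨ shuffle (nested i (suc c)) (2 ^ i) (i !) (c !) ((c + i) !) ⟩
    2 ^ i * i ! * c ! * nested i (suc c) * (c + i) !
  ≡⟨ cong (_* (c + i) !) (nested-closed-form i c) ⟩
    (c + 2 * i) ! * (c + i) !
  ≡⟨ cong ((c + 2 * i) ! *_) (sym (nCk*k!*[n∸k]!≡n! (m≤n+m i c))) ⟩
    (c + 2 * i) ! * (((c + i) C i) * (i ! * (c + i ∸ i) !))
  ≡⟨ cong (λ d → (c + 2 * i) ! * (((c + i) C i) * (i ! * d !))) (m+n∸n≡m c i) ⟩
    (c + 2 * i) ! * (((c + i) C i) * (i ! * c !))
  ≡⟨ sym (*-assoc ((c + 2 * i) !) ((c + i) C i) (i ! * c !)) ⟩
    (c + 2 * i) ! * ((c + i) C i) * (i ! * c !) ∎)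
  where
  open ≡-Reasoning
  shuffle : ∀ x p f g h → x * p * h * (f * g) ≡ p * f * g * x * h
  shuffle = solve-∀

summand : ℕ → ℕ → ℕ
summand n i = nested i (n + 1 ∸ 2 * i) * 2 ^ i * (n ∸ i) !

+-2*∸ : ∀ c i → c + 2 * i ∸ i ≡ c + i
+-2*∸ c i = trans (cong (_∸ i) (+-2*-assoc c i)) (m+n∸n≡m (c + i) i)
  where
  +-2*-assoc : ∀ c i → c + 2 * i ≡ c + i + i
  +-2*-assoc = solve-∀

summand-+2* : ∀ c i → summand (c + 2 * i) i ≡ (c + 2 * i) ! * diagonal (c + 2 * i) i
summand-+2* c i = begin
    nested i (c + 2 * i + 1 ∸ 2 * i) * 2 ^ i * (c + 2 * i ∸ i) !
  ≡⟨ cong₂ (λ b d → nested i b * 2 ^ i * d !) +1∸2i (+-2*∸ c i) ⟩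
    nested i (suc c) * 2 ^ i * (c + i) !
  ≡⟨ nested-binomial i c ⟩
    (c + 2 * i) ! * ((c + i) C i)
  ≡⟨ cong (λ d → (c + 2 * i) ! * (d C i)) (sym (+-2*∸ c i)) ⟩
    (c + 2 * i) ! * ((c + 2 * i ∸ i) C i) ∎
  where
  open ≡-Reasoning
  +1∸2i : c + 2 * i + 1 ∸ 2 * i ≡ suc c
  +1∸2i = trans (cong (_∸ 2 * i) (+-comm (c + 2 * i) 1)) (m+n∸n≡m (suc c) (2 * i))

summand-≡0 : ∀ n k → n < 2 * suc k → summand n (suc k) ≡ 0
summand-≡0 n k n<2i rewrite m≤n⇒m∸n≡0 (subst (_≤ 2 * suc k) (+-comm 1 n) n<2i) = refl

diagonal-≡0 : ∀ n k → n < 2 * suc k → diagonal n (suc k) ≡ 0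
diagonal-≡0 n k n<2i =
  k>n⇒nCk≡0 (m<n+o⇒m∸n<o n (suc k) (subst (n <_) (cong (suc k +_) (+-identityʳ (suc k))) n<2i))

summand≡n!*diagonal : ∀ n i → summand n i ≡ n ! * diagonal n i
summand≡n!*diagonal n i with 2 * i ≤? n
... | yes 2i≤n = subst (λ n → summand n i ≡ n ! * diagonal n i) (m∸n+n≡m 2i≤n) (summand-+2* (n ∸ 2 * i) i)
summand≡n!*diagonal n zero    | no 2i≰n = contradiction z≤n 2i≰n
summand≡n!*diagonal n (suc k) | no 2i≰n = begin
    summand n (suc k)          ≡⟨ summand-≡0 n k (≰⇒> 2i≰n) ⟩
    0                          ≡⟨ sym (*-zeroʳ (n !)) ⟩
    n ! * 0                    ≡⟨ cong (n ! *_) (sym (diagonal-≡0 n k (≰⇒> 2i≰n))) ⟩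
    n ! * diagonal n (suc k)   ∎
  where open ≡-Reasoning

n≤[n+1]/2+[n+1]/2 : ∀ n → n ≤ (n + 1) / 2 + (n + 1) / 2
n≤[n+1]/2+[n+1]/2 n = s≤s⁻¹ (begin
    suc n                          ≡⟨ +-comm 1 n ⟩
    n + 1                          ≡⟨ m≡m%n+[m/n]*n (n + 1) 2 ⟩
    (n + 1) % 2 + q * 2            ≤⟨ +-monoˡ-≤ (q * 2) (s≤s⁻¹ (m%n<n (n + 1) 2)) ⟩
    1 + q * 2                      ≡⟨ cong suc (trans (*-comm q 2) (cong (q +_) (+-identityʳ q))) ⟩
    suc (q + q)                    ∎)
  where
  open ≤-Reasoning
  q : ℕ
  q = (n + 1) / 2

corollary9 : (N : ℕ) → N ! * (F N ∸ 1) ≡ bigSum N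
corollary9 N = begin
    N ! * (F N ∸ 1)                        ≡⟨ cong (λ f → N ! * (f ∸ 1)) (sym (fib-diagonal N M (n≤[n+1]/2+[n+1]/2 N))) ⟩
    N ! * (Σ1 M (diagonal N) + 1 ∸ 1)      ≡⟨ cong (N ! *_) (m+n∸n≡m (Σ1 M (diagonal N)) 1) ⟩
    N ! * Σ1 M (diagonal N)                ≡⟨ *-distribˡ-Σ1 M (N !) (diagonal N) ⟩
    Σ1 M (λ i → N ! * diagonal N i)        ≡⟨ Σ1-cong M (λ k → sym (summand≡n!*diagonal N (suc k))) ⟩
    bigSum N                               ∎
  where
  open ≡-Reasoning
  M : ℕ
  M = (N + 1) / 2
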